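{- Let $\Gamma$ be a vertex-transitive bipartite graph with $\mathrm{diam}(\Gamma)=3$. Then $\Gamma$ admits an optimal extended irregular dominating set if and only if $\Gamma$ is a crown graph.
   Context: For an integer $n\ge3$, the crown graph of order $2n$ is $K_{n,n}$ with parts $\{a_1,\dots,a_n\}$, $\{b_1,\dots,b_n\}$ minus the perfect matching $\{\{a_i,b_i\}:1\le i\le n\}$. For a graph $\Gamma=(V,E)$ with distance $d$ and diameter $\mathrm{diam}(\Gamma)$: a vertex $v$ carrying a positive integer label $\ell$ dominates exactly the vertices $u$ with $d(u,v)=\ell$; a vertex carrying label $0$ dominates only itself. A $k$-extended irregular dominating set is a set $S\subseteq V$ of $k$ vertices together with an injective labeling $\lambda:S\to\{0,1,2,\dots\}$ such that every vertex of $V$ is dominated by some vertex of $S$, where some vertex of $S$ has label $0$. $\gamma_e(\Gamma)$ is the minimum cardinality of such a set, and the set is optimal if $k=\gamma_e(\Gamma)$. -}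

module Defs where

open import Level using (0ℓ)
open import Data.Nat using (ℕ; zero; suc; _≤_; _<_)
open import Data.Fin using (Fin)
open import Data.Bool using (Bool)
open import Data.Sum using (_⊎_; inj₁; inj₂)
open import Data.Product using (Σ; ∃; ∃-syntax; _×_; _,_)
open import Data.Empty using (⊥)
open import Relation.Nullary using (¬_)
open import Relation.Binary.PropositionalEquality using (_≡_; _≢_)
open import Function.Bundles using (_↔_; Inverse)
open import Function.Definitions using (Injective)

record Graph : Set₁ where
  field
    order : ℕ
    Adj   : Fin order → Fin order → Set
    sym   : ∀ {u v} → Adj u v → Adj v u
    irrefl : ∀ {u} → ¬ Adj u u

open Graph public

module _ (Γ : Graph) where
  private
    V = Fin (order Γ)

  data Walk : V → V → ℕ → Set where
    here : ∀ {u} → Walk u u zero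
    step : ∀ {u w v ℓ} → Adj Γ u w → Walk w v ℓ → Walk u v (suc ℓ)

  Dist : V → V → ℕ → Set
  Dist u v ℓ = Walk u v ℓ × (∀ m → m < ℓ → ¬ Walk u v m)

  Diameter : ℕ → Set
  Diameter d = (∀ u v → ∃[ ℓ ] (ℓ ≤ d × Dist u v ℓ))
             × (∃[ u ] ∃[ v ] Dist u v d)

  Bipartite : Set
  Bipartite = Σ (V → Bool) λ c → (∀ {u v} → Adj Γ u v → c u ≢ c v)

  IsAutomorphism : (V ↔ V) → Set
  IsAutomorphism σ = ∀ u v → (Adj Γ u v → Adj Γ (Inverse.to σ u) (Inverse.to σ v))
                           × (Adj Γ (Inverse.to σ u) (Inverse.to σ v) → Adj Γ u v)

  VertexTransitive : Set
  VertexTransitive = ∀ u v → Σ (V ↔ V) λ σ → IsAutomorphism σ × Inverse.to σ u ≡ v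

  Dominates : V → ℕ → V → Set
  Dominates v zero    u = u ≡ v
  Dominates v (suc ℓ) u = Dist u v (suc ℓ)

  record EIDS (k : ℕ) : Set where
    field
      vertex  : Fin k → V
      label   : Fin k → ℕ
      vertex-injective : Injective _≡_ _≡_ vertex
      label-injective  : Injective _≡_ _≡_ label
      has-zero  : ∃[ i ] (label i ≡ 0)
      dominating : ∀ u → ∃[ i ] Dominates (vertex i) (label i) u

  IsGammaE : ℕ → Set
  IsGammaE g = EIDS g × (∀ k → EIDS k → g ≤ k)

  AdmitsOptimalEIDS : Set
  AdmitsOptimalEIDS = ∃[ k ] (EIDS k × IsGammaE k)

-- The crown graph of order 2n on Fin n ⊎ Fin n (inj₁ i = a_i, inj₂ i = b_i).
CrownAdj : (n : ℕ) → Fin n ⊎ Fin n → Fin n ⊎ Fin n → Set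
CrownAdj n (inj₁ i) (inj₁ j) = ⊥
CrownAdj n (inj₁ i) (inj₂ j) = i ≢ j
CrownAdj n (inj₂ i) (inj₁ j) = i ≢ j
CrownAdj n (inj₂ i) (inj₂ j) = ⊥

IsCrownGraph : Graph → Set
IsCrownGraph Γ = ∃[ n ] (3 ≤ n × Σ (Fin (order Γ) ↔ (Fin n ⊎ Fin n)) λ φ →
  ∀ u v → (Adj Γ u v → CrownAdj n (Inverse.to φ u) (Inverse.to φ v))
        × (CrownAdj n (Inverse.to φ u) (Inverse.to φ v) → Adj Γ u v))

module Submission where

-- In a bipartite graph of diameter 3 a vertex with label 0, 1, 2, 3 dominates exactly
-- itself, its neighbours, the other vertices of its colour class, and the non-neighbours
-- in the other class (the vertices far from it).  Chasing how the vertices around the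
-- carrier of label 3 can be dominated shows that every extended irregular dominating set
-- uses all of the labels 0, 1, 2, 3, and that the carrier of label 0 is the only vertex
-- far from the carrier of label 1.  Vertex-transitivity spreads this: every vertex has a
-- unique antipode, and two vertices of different colours are adjacent unless antipodal,
-- which is the crown graph.  Conversely, in a crown graph b₁, a₁, a₀, b₀ with labels
-- 0, 1, 2, 3 dominate everything, so γₑ = 4 and optimal sets exist.

open import Defs renaming (sym to adj-sym)
open import Data.Bool using (Bool; true; false; not; _xor_; T) renaming (_≟_ to _≟ᵇ_)
open import Data.Bool.Properties using (¬-not; not-¬; not-distribˡ-xor; not-distribʳ-xor; T?; T-irrelevant)
open import Data.Empty using (⊥; ⊥-elim)
open import Data.Unit using (tt)
open import Data.Fin using (Fin; zero; suc; toℕ; _≟_)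
open import Data.Fin.Patterns using (0F; 1F; 2F; 3F)
open import Data.Fin.Properties using (0↔⊥; 1↔⊤; +↔⊎; any?; toℕ-injective; injective⇒≤) renaming (0≢1+n to 0F≢suc)
open import Data.Nat using (ℕ; zero; suc; _+_; _≤_; z≤n; s≤s) renaming (_≟_ to _≟ℕ_)
open import Data.Nat.Properties using (≤-trans; m≤m+n; n≤1+n; 0≢1+n)
open import Data.Product using (Σ; ∃-syntax; _×_; _,_; proj₁; proj₂)
open import Data.Sum using (_⊎_; inj₁; inj₂)
open import Data.Sum.Properties using (inj₁-injective)
open import Data.Sum.Function.Propositional using (_⊎-↔_)
open import Function using (_∘_)
open import Function.Bundles using (_↔_; _⇔_; Inverse; Injection; mk↔ₛ′; mk⇔)
open import Function.Definitions using (Injective)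
open import Function.Properties.Inverse using (↔-sym; ↔-trans; ↔⇒↣)
open import Relation.Nullary using (¬_; Dec; yes; no)
open import Relation.Binary.PropositionalEquality
  using (_≡_; _≢_; refl; sym; trans; cong; subst; subst₂; module ≡-Reasoning)

↔-to-injective : ∀ {A B : Set} (φ : A ↔ B) → Injective _≡_ _≡_ (Inverse.to φ)
↔-to-injective φ = Injection.injective (↔⇒↣ φ)

both-≢⇒≡ : ∀ {a b d : Bool} → a ≢ d → b ≢ d → a ≡ b
both-≢⇒≡ a≢d b≢d = trans (¬-not a≢d) (sym (¬-not b≢d))

T-unique : ∀ {a b} → T a → T b → a ≡ b
T-unique {true} {true} _ _ = refl

T-opposite : ∀ {a b} → a ≢ b → T b → ¬ T a
T-opposite {true} {true} a≢b _ _ = a≢b refl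

opposite-T : ∀ {a b} → a ≢ b → ¬ T b → T a
opposite-T {true}          _   _  = tt
opposite-T {false} {false} a≢b _  = a≢b refl
opposite-T {false} {true}  _   ¬t = ¬t tt

3≤-of-distinct : ∀ {n} {i j k : Fin n} → i ≢ j → i ≢ k → j ≢ k → 3 ≤ n
3≤-of-distinct {i = i} {j} {k} i≢j i≢k j≢k = injective⇒≤ f-injective
  where
  f : Fin 3 → Fin _
  f 0F = i
  f 1F = j
  f 2F = k
  f-injective : Injective _≡_ _≡_ f
  f-injective {0F} {0F} _ = refl
  f-injective {0F} {1F} e = ⊥-elim (i≢j e)
  f-injective {0F} {2F} e = ⊥-elim (i≢k e)
  f-injective {1F} {0F} e = ⊥-elim (i≢j (sym e))
  f-injective {1F} {1F} _ = refl
  f-injective {1F} {2F} e = ⊥-elim (j≢k e)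
  f-injective {2F} {0F} e = ⊥-elim (i≢k (sym e))
  f-injective {2F} {1F} e = ⊥-elim (j≢k (sym e))
  f-injective {2F} {2F} _ = refl

T↔Fin : (b : Bool) → ∃[ m ] (T b ↔ Fin m)
T↔Fin true  = 1 , ↔-sym 1↔⊤
T↔Fin false = 0 , ↔-sym 0↔⊥

Σ-suc↔⊎ : ∀ {N} (Q : Fin (suc N) → Set) → Σ (Fin (suc N)) Q ↔ (Q zero ⊎ Σ (Fin N) (Q ∘ suc))
Σ-suc↔⊎ Q = mk↔ₛ′ to from (λ { (inj₁ _) → refl ; (inj₂ _) → refl })
                          (λ { (zero , _) → refl ; (suc _ , _) → refl })
  where
  to : Σ (Fin _) Q → Q zero ⊎ Σ (Fin _) (Q ∘ suc)
  to (zero  , q) = inj₁ q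
  to (suc i , q) = inj₂ (i , q)
  from : Q zero ⊎ Σ (Fin _) (Q ∘ suc) → Σ (Fin _) Q
  from (inj₁ q)       = zero , q
  from (inj₂ (i , q)) = suc i , q

Σ-Fin↔Fin : ∀ {N} (Q : Fin N → Set) → (∀ i → ∃[ m ] (Q i ↔ Fin m)) →
            ∃[ n ] (Σ (Fin N) Q ↔ Fin n)
Σ-Fin↔Fin {zero}  Q finite = 0 , mk↔ₛ′ (λ { (() , _) }) (λ ()) (λ ()) (λ { (() , _) })
Σ-Fin↔Fin {suc N} Q finite =
  let (m , first) = finite zero
      (n , rest) = Σ-Fin↔Fin (Q ∘ suc) (finite ∘ suc)
  in m + n , ↔-trans (Σ-suc↔⊎ Q) (↔-trans (first ⊎-↔ rest) (↔-sym +↔⊎))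

module _ {Γ : Graph} where
  walk0⇒≡ : ∀ {u v} → Walk Γ u v 0 → u ≡ v
  walk0⇒≡ here = refl

  walk1⇒adj : ∀ {u v} → Walk Γ u v 1 → Adj Γ u v
  walk1⇒adj (step u~v here) = u~v

  adj⇒dist1 : ∀ {u v} → Adj Γ u v → Dist Γ u v 1
  adj⇒dist1 {u} u~v = step u~v here , λ { zero (s≤s z≤n) W → irrefl Γ (subst (Adj Γ u) (sym (walk0⇒≡ W)) u~v) }

module _ (Γ : Graph) where
  private
    V = Fin (order Γ)

  TwoNeighbours : V → Set
  TwoNeighbours v = ∃[ p ] ∃[ q ] (Adj Γ v p × Adj Γ v q × p ≢ q)

  neighbour-avoiding : ∀ {v} → TwoNeighbours v → ∀ t → ∃[ r ] (Adj Γ v r × r ≢ t)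
  neighbour-avoiding (p , q , v~p , v~q , p≢q) t with p ≟ t
  ... | yes refl = q , v~q , p≢q ∘ sym
  ... | no p≢t   = p , v~p , p≢t

  dist≥2⇒two-neighbours : ∀ {u v ℓ} → Dist Γ u v (suc (suc ℓ)) → ∃[ p ] TwoNeighbours p
  dist≥2⇒two-neighbours {ℓ = ℓ} (step {w = p} u~p (step {w = q} p~q W) , shortest) =
    p , _ , q , adj-sym Γ u~p , p~q , λ { refl → shortest ℓ (s≤s (n≤1+n ℓ)) W }

  IsIsomorphism : ∀ {W : Set} → V ↔ W → (W → W → Set) → Set
  IsIsomorphism φ R = ∀ u v → (Adj Γ u v → R (Inverse.to φ u) (Inverse.to φ v))
                            × (R (Inverse.to φ u) (Inverse.to φ v) → Adj Γ u v)

  module _ {W : Set} (φ : V ↔ W) {R : W → W → Set} where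
    open Inverse φ

    isomorphism-via-from : (∀ s t → (Adj Γ (from s) (from t) → R s t) × (R s t → Adj Γ (from s) (from t))) →
                           IsIsomorphism φ R
    isomorphism-via-from iso u v =
        (λ u~v → proj₁ (iso (to u) (to v)) (subst₂ (Adj Γ) (sym (strictlyInverseʳ u)) (sym (strictlyInverseʳ v)) u~v))
      , (λ r → subst₂ (Adj Γ) (strictlyInverseʳ u) (strictlyInverseʳ v) (proj₂ (iso (to u) (to v)) r))

    isomorphism-from : IsIsomorphism φ R →
                       ∀ s t → (Adj Γ (from s) (from t) → R s t) × (R s t → Adj Γ (from s) (from t))
    isomorphism-from iso s t =
        (λ a → subst₂ R (strictlyInverseˡ s) (strictlyInverseˡ t) (proj₁ (iso (from s) (from t)) a))
      , (λ r → proj₂ (iso (from s) (from t)) (subst₂ R (sym (strictlyInverseˡ s)) (sym (strictlyInverseˡ t)) r))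

module Bipartite (Γ : Graph) (c : Fin (order Γ) → Bool)
                 (proper : ∀ {u v} → Adj Γ u v → c u ≢ c v) where
  private
    V = Fin (order Γ)

  odd : ℕ → Bool
  odd zero    = false
  odd (suc ℓ) = not (odd ℓ)

  walk-colour : ∀ {u v ℓ} → Walk Γ u v ℓ → c v ≡ odd ℓ xor c u
  walk-colour here = refl
  walk-colour {u} {v} (step {w = w} {ℓ = ℓ} u~w W) = begin
    c v                   ≡⟨ walk-colour W ⟩
    odd ℓ xor c w         ≡⟨ cong (odd ℓ xor_) (¬-not (proper u~w ∘ sym)) ⟩
    odd ℓ xor not (c u)   ≡⟨ sym (not-distribʳ-xor (odd ℓ) (c u)) ⟩
    not (odd ℓ xor c u)   ≡⟨ not-distribˡ-xor (odd ℓ) (c u) ⟩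
    not (odd ℓ) xor c u   ∎
    where open ≡-Reasoning

  even-walk⇒same-colour : ∀ {u v ℓ} → Walk Γ u v ℓ → odd ℓ ≡ false → c u ≡ c v
  even-walk⇒same-colour W even = sym (trans (walk-colour W) (cong (_xor _) even))

  same-colour⇒even-walk : ∀ {u v ℓ} → Walk Γ u v ℓ → c u ≡ c v → odd ℓ ≡ false
  same-colour⇒even-walk {u} {ℓ = ℓ} W same with odd ℓ in parity
  ... | false = refl
  ... | true  = ⊥-elim (not-¬ refl (trans same (trans (walk-colour W) (cong (_xor c u) parity))))

  walks-transfer-colour : ∀ {u v u′ v′ ℓ} → Walk Γ u v ℓ → Walk Γ u′ v′ ℓ → c u ≡ c v → c u′ ≡ c v′
  walks-transfer-colour W W′ = even-walk⇒same-colour W′ ∘ same-colour⇒even-walk W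

  Far : V → V → Set
  Far u v = c u ≢ c v × ¬ Adj Γ u v

  far-sym : ∀ {u v} → Far u v → Far v u
  far-sym (opposite , u≁v) = opposite ∘ sym , u≁v ∘ adj-sym Γ

  module UniqueAntipodes (adj? : ∀ u v → Dec (Adj Γ u v))
                         (far-exists : ∀ u → ∃[ a ] Far u a)
                         (far-unique : ∀ u {a a′} → Far u a → Far u a′ → a ≡ a′) where
    antipode : V → V
    antipode u = proj₁ (far-exists u)

    antipode-far : ∀ u → Far u (antipode u)
    antipode-far u = proj₂ (far-exists u)

    antipode-involutive : ∀ u → antipode (antipode u) ≡ u
    antipode-involutive u = far-unique (antipode u) (antipode-far (antipode u)) (far-sym (antipode-far u))

    antipode-injective : ∀ {u v} → antipode u ≡ antipode v → u ≡ v
    antipode-injective {u} {v} e =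
      trans (sym (antipode-involutive u)) (trans (cong antipode e) (antipode-involutive v))

    antipode-colour : ∀ u → c (antipode u) ≡ not (c u)
    antipode-colour u = ¬-not (proj₁ (antipode-far u) ∘ sym)

    antipode-true : ∀ {u} → ¬ T (c u) → T (c (antipode u))
    antipode-true {u} = opposite-T (proj₁ (antipode-far u) ∘ sym)

    adj⇒≢antipode : ∀ {u v} → Adj Γ u v → v ≢ antipode u
    adj⇒≢antipode {u} u~v refl = proj₂ (antipode-far u) u~v

    opposite⇒adj : ∀ {u v} → c u ≢ c v → v ≢ antipode u → Adj Γ u v
    opposite⇒adj {u} {v} opposite v≢ with adj? u v
    ... | yes u~v = u~v
    ... | no  u≁v = ⊥-elim (v≢ (far-unique u (opposite , u≁v) (antipode-far u)))

    private
      enumeration = Σ-Fin↔Fin (T ∘ c) (T↔Fin ∘ c)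

    n : ℕ
    n = proj₁ enumeration

    open Inverse (proj₂ enumeration)

    index : ∀ u → T (c u) → Fin n
    index u t = to (u , t)

    member : Fin n → V
    member i = proj₁ (from i)

    member-true : ∀ i → T (c (member i))
    member-true i = proj₂ (from i)

    member-index : ∀ u t → member (index u t) ≡ u
    member-index u t = cong proj₁ (strictlyInverseʳ (u , t))

    index-cong : ∀ {u v t t′} → u ≡ v → index u t ≡ index v t′
    index-cong {u} {t = t} {t′} refl = cong (index u) (T-irrelevant t t′)

    index-member : ∀ i t → index (member i) t ≡ i
    index-member i t = trans (index-cong refl) (strictlyInverseˡ i)

    index-injective : ∀ {u v t t′} → index u t ≡ index v t′ → u ≡ v
    index-injective {u} {v} {t} {t′} e =
      trans (sym (member-index u t)) (trans (cong member e) (member-index v t′))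

    member-injective : ∀ {i j} → member i ≡ member j → i ≡ j
    member-injective {i} {j} e =
      trans (sym (index-member i (member-true i))) (trans (index-cong e) (index-member j (member-true j)))

    split : V → Fin n ⊎ Fin n
    split u with T? (c u)
    ... | yes t = inj₁ (index u t)
    ... | no ¬t = inj₂ (index (antipode u) (antipode-true ¬t))

    unsplit : Fin n ⊎ Fin n → V
    unsplit (inj₁ i) = member i
    unsplit (inj₂ i) = antipode (member i)

    unsplit-split : ∀ u → unsplit (split u) ≡ u
    unsplit-split u with T? (c u)
    ... | yes t = member-index u t
    ... | no ¬t = trans (cong antipode (member-index _ _)) (antipode-involutive u)

    split-true : ∀ u (t : T (c u)) → split u ≡ inj₁ (index u t)
    split-true u t with T? (c u)
    ... | yes _ = cong inj₁ (index-cong refl)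
    ... | no ¬t = ⊥-elim (¬t t)

    split-false : ∀ u (¬t : ¬ T (c u)) → split u ≡ inj₂ (index (antipode u) (antipode-true ¬t))
    split-false u ¬t with T? (c u)
    ... | yes t = ⊥-elim (¬t t)
    ... | no _  = cong inj₂ (index-cong refl)

    split-unsplit : ∀ s → split (unsplit s) ≡ s
    split-unsplit (inj₁ i) = trans (split-true (member i) (member-true i)) (cong inj₁ (index-member i _))
    split-unsplit (inj₂ i) =
      trans (split-false (antipode w) (T-opposite (proj₁ (antipode-far w) ∘ sym) (member-true i)))
            (cong inj₂ (trans (index-cong (antipode-involutive w)) (index-member i (member-true i))))
      where w = member i

    member-adj-antipode : ∀ i j → (Adj Γ (member i) (antipode (member j)) → i ≢ j)
                                × (i ≢ j → Adj Γ (member i) (antipode (member j)))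
    member-adj-antipode i j =
        (λ a i≡j → adj⇒≢antipode a (cong (antipode ∘ member) (sym i≡j)))
      , (λ i≢j → opposite⇒adj opposite (i≢j ∘ member-injective ∘ sym ∘ antipode-injective))
      where
      opposite : c (member i) ≢ c (antipode (member j))
      opposite e = not-¬ (T-unique (member-true i) (member-true j)) (trans e (antipode-colour (member j)))

    crown-adjacency : ∀ s t → (Adj Γ (unsplit s) (unsplit t) → CrownAdj n s t)
                            × (CrownAdj n s t → Adj Γ (unsplit s) (unsplit t))
    crown-adjacency (inj₁ i) (inj₁ j) = (λ a → proper a (T-unique (member-true i) (member-true j))) , λ ()
    crown-adjacency (inj₁ i) (inj₂ j) = member-adj-antipode i j
    crown-adjacency (inj₂ i) (inj₁ j) =
        (λ a → proj₁ (member-adj-antipode j i) (adj-sym Γ a) ∘ sym)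
      , (λ i≢j → adj-sym Γ (proj₂ (member-adj-antipode j i) (i≢j ∘ sym)))
    crown-adjacency (inj₂ i) (inj₂ j) = (λ a → proper a antipodes-same-colour) , λ ()
      where
      antipodes-same-colour : c (antipode (member i)) ≡ c (antipode (member j))
      antipodes-same-colour = trans (antipode-colour _)
        (trans (cong not (T-unique (member-true i) (member-true j))) (sym (antipode-colour _)))

    class-vertex : V → ∃[ a ] T (c a)
    class-vertex u with T? (c u)
    ... | yes t = u , t
    ... | no ¬t = antipode u , antipode-true ¬t

    3≤n : V → (∀ v → TwoNeighbours Γ v) → 3 ≤ n
    3≤n u two-neighbours with class-vertex u
    ... | a , ta with two-neighbours a
    ... | p , q , a~p , a~q , p≢q =
      3≤-of-distinct {k = antipode-index a~q} (a≢antipode a~p) (a≢antipode a~q)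
                     (p≢q ∘ antipode-injective ∘ index-injective)
      where
      antipode-index : ∀ {r} → Adj Γ a r → Fin n
      antipode-index {r} a~r = index (antipode r) (antipode-true (T-opposite (proper a~r ∘ sym) ta))
      a≢antipode : ∀ {r} (a~r : Adj Γ a r) → index a ta ≢ antipode-index a~r
      a≢antipode a~r e = adj⇒≢antipode (adj-sym Γ a~r) (index-injective e)

    -- The vertex argument only witnesses that the graph is nonempty.
    crown : V → (∀ v → TwoNeighbours Γ v) → IsCrownGraph Γ
    crown u two-neighbours = n , 3≤n u two-neighbours , φ , isomorphism-via-from Γ φ crown-adjacency
      where
      φ : V ↔ (Fin n ⊎ Fin n)
      φ = mk↔ₛ′ split unsplit split-unsplit unsplit-split

  module DiameterAtMost3 (close : ∀ u v → ∃[ ℓ ] (ℓ ≤ 3 × Dist Γ u v ℓ)) where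
    Reach : V → ℕ → V → Set
    Reach v 0 u = u ≡ v
    Reach v 1 u = Adj Γ u v
    Reach v 2 u = c u ≡ c v × u ≢ v
    Reach v 3 u = Far u v
    Reach v (suc (suc (suc (suc _)))) u = ⊥

    dominates⇒reach : ∀ {v u} ℓ → Dominates Γ v ℓ u → Reach v ℓ u
    dominates⇒reach 0 u≡v = u≡v
    dominates⇒reach 1 (W , _) = walk1⇒adj W
    dominates⇒reach 2 (W , shortest) = even-walk⇒same-colour W refl , λ { refl → shortest 0 (s≤s z≤n) here }
    dominates⇒reach 3 (W , shortest) =
      (λ same → 3-odd (same-colour⇒even-walk W same)) , λ u~v → shortest 1 (s≤s (s≤s z≤n)) (step u~v here)
      where
      3-odd : odd 3 ≢ false
      3-odd ()
    dominates⇒reach {v} {u} (suc (suc (suc (suc ℓ)))) (_ , shortest) =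
      let (ℓ′ , ℓ′≤3 , W , _) = close u v in shortest ℓ′ (s≤s (≤-trans ℓ′≤3 (m≤m+n 3 ℓ))) W

    reach⇒dominates : ∀ {v u} ℓ → Reach v ℓ u → Dominates Γ v ℓ u
    reach⇒dominates 0 u≡v = u≡v
    reach⇒dominates 1 u~v = adj⇒dist1 u~v
    reach⇒dominates {v} {u} 2 (same , u≢v) with close u v
    ... | 0 , _ , W , _ = ⊥-elim (u≢v (walk0⇒≡ W))
    ... | 1 , _ , W , _ = ⊥-elim (proper (walk1⇒adj W) same)
    ... | 2 , _ , d     = d
    ... | 3 , _ , W , _ with same-colour⇒even-walk W same
    ...   | ()
    reach⇒dominates 2 _ | suc (suc (suc (suc _))) , s≤s (s≤s (s≤s ())) , _
    reach⇒dominates {v} {u} 3 (opposite , u≁v) with close u v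
    ... | 0 , _ , W , _ = ⊥-elim (opposite (cong c (walk0⇒≡ W)))
    ... | 1 , _ , W , _ = ⊥-elim (u≁v (walk1⇒adj W))
    ... | 2 , _ , W , _ = ⊥-elim (opposite (even-walk⇒same-colour W refl))
    ... | 3 , _ , d     = d
    ... | suc (suc (suc (suc _))) , s≤s (s≤s (s≤s ())) , _

    adj? : ∀ u v → Dec (Adj Γ u v)
    adj? u v with close u v
    ... | 0 , _ , W , _ = no λ u~v → irrefl Γ (subst (Adj Γ u) (sym (walk0⇒≡ W)) u~v)
    ... | 1 , _ , W , _ = yes (walk1⇒adj W)
    ... | suc (suc _) , _ , _ , shortest = no λ u~v → shortest 1 (s≤s (s≤s z≤n)) (step u~v here)

    module Automorphism (σ : V ↔ V) (σ-auto : IsAutomorphism Γ σ) where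
      open Inverse σ public using (from; strictlyInverseˡ) renaming (to to s)

      s-adj : ∀ {u w} → Adj Γ u w → Adj Γ (s u) (s w)
      s-adj = proj₁ (σ-auto _ _)

      map-walk : ∀ {u v ℓ} → Walk Γ u v ℓ → Walk Γ (s u) (s v) ℓ
      map-walk here         = here
      map-walk (step u~w W) = step (s-adj u~w) (map-walk W)

      same-colour-image : ∀ u v → c u ≡ c v → c (s u) ≡ c (s v)
      same-colour-image u v = let (_ , _ , W , _) = close u v in walks-transfer-colour W (map-walk W)

      same-colour-preimage : ∀ u v → c (s u) ≡ c (s v) → c u ≡ c v
      same-colour-preimage u v = let (_ , _ , W , _) = close u v in walks-transfer-colour (map-walk W) W

      far-image : ∀ {u v} → Far u v → Far (s u) (s v)
      far-image {u} {v} (opposite , u≁v) =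
        opposite ∘ same-colour-preimage u v , u≁v ∘ proj₂ (σ-auto u v)

      far-preimage : ∀ {u v} → Far (s u) (s v) → Far u v
      far-preimage {u} {v} (opposite , u≁v) =
        opposite ∘ same-colour-image u v , u≁v ∘ s-adj

    module Transitive (vt : VertexTransitive Γ) {u₀ v₀ : V} (diametral : Dist Γ u₀ v₀ 3) where
      far-exists : ∀ u → ∃[ a ] Far u a
      far-exists u with vt u₀ u
      ... | σ , σ-auto , refl = s v₀ , far-image (dominates⇒reach 3 diametral)
        where open Automorphism σ σ-auto

      two-neighbours : ∀ v → TwoNeighbours Γ v
      two-neighbours v with dist≥2⇒two-neighbours Γ diametral
      ... | p , q , r , p~q , p~r , q≢r with vt p v
      ...   | σ , σ-auto , refl = s q , s r , s-adj p~q , s-adj p~r , q≢r ∘ ↔-to-injective σ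
        where open Automorphism σ σ-auto

      far-unique : ∀ {x y} → (∀ a → Far y a → a ≡ x) → ∀ u {a a′} → Far u a → Far u a′ → a ≡ a′
      far-unique {x} {y} unique-at-y u far far′ with vt y u
      ... | σ , σ-auto , refl = ↔-to-injective (↔-sym σ) (trans (pull far) (sym (pull far′)))
        where
        open Automorphism σ σ-auto
        pull : ∀ {a} → Far (s y) a → from a ≡ x
        pull {a} far = unique-at-y (from a) (far-preimage (subst (Far (s y)) (sym (strictlyInverseˡ a)) far))

    module EIDSAnalysis (two-neighbours : ∀ v → TwoNeighbours Γ v) {k} (E : EIDS Γ k) where
      open EIDS E

      Carries : ℕ → V → Set
      Carries ℓ v = ∃[ i ] (label i ≡ ℓ × vertex i ≡ v)

      carrier-unique : ∀ {ℓ v v′} → Carries ℓ v → Carries ℓ v′ → v ≡ v′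
      carrier-unique (i , refl , refl) (j , ℓ≡ , refl) = cong vertex (label-injective (sym ℓ≡))

      carried-label-unique : ∀ {ℓ ℓ′ v} → Carries ℓ v → Carries ℓ′ v → ℓ ≡ ℓ′
      carried-label-unique (i , refl , refl) (j , refl , v≡) = cong label (vertex-injective (sym v≡))

      carrier? : ∀ ℓ → Dec (∃[ v ] Carries ℓ v)
      carrier? ℓ with any? (λ i → label i ≟ℕ ℓ)
      ... | yes (i , ℓ≡) = yes (vertex i , i , ℓ≡ , refl)
      ... | no ∄i        = no λ (_ , i , ℓ≡ , _) → ∄i (i , ℓ≡)

      carriers⇒≤ : ∀ {m} → (∀ (ℓ : Fin m) → ∃[ v ] Carries (toℕ ℓ) v) → m ≤ k
      carriers⇒≤ carriers = injective⇒≤ {f = index} λ {ℓ} {ℓ′} e →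
        toℕ-injective (trans (sym (index-label ℓ)) (trans (cong label e) (index-label ℓ′)))
        where
        index : Fin _ → Fin k
        index ℓ = proj₁ (proj₂ (carriers ℓ))
        index-label : ∀ ℓ → label (index ℓ) ≡ toℕ ℓ
        index-label ℓ = proj₁ (proj₂ (proj₂ (carriers ℓ)))

      dominator : ∀ u → ∃[ ℓ ] ∃[ v ] (Carries ℓ v × Reach v ℓ u)
      dominator u = let (i , d) = dominating u in label i , vertex i , (i , refl , refl) , dominates⇒reach (label i) d

      x : V
      x = vertex (proj₁ has-zero)

      x-carries-0 : Carries 0 x
      x-carries-0 = proj₁ has-zero , proj₂ has-zero , refl

      Coloured : ℕ → Bool → Set
      Coloured ℓ b = ∀ v → Carries ℓ v → c v ≡ b

      vertex-of-colour≢x : ∀ b → ∃[ q ] (c q ≡ b × q ≢ x)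
      vertex-of-colour≢x b with neighbour-avoiding Γ (two-neighbours x) x
      ... | p , x~p , p≢x with c x ≟ᵇ b
      ...   | no cx≢b = p , both-≢⇒≡ (proper x~p ∘ sym) (cx≢b ∘ sym) , p≢x
      ...   | yes refl with neighbour-avoiding Γ (two-neighbours p) x
      ...     | r , p~r , r≢x = r , both-≢⇒≡ (proper p~r ∘ sym) (proper x~p) , r≢x

      two-undominated : ∀ {y z} → Carries 1 y → Carries 2 z → c z ≡ c y → Coloured 3 (c y) → ⊥
      two-undominated {y} {z} y₁ z₂ same threes with dominator z
      ... | 0 , v , v₀ , refl = 0≢1+n (carried-label-unique v₀ z₂)
      ... | 1 , v , v₁ , z~v with carrier-unique v₁ y₁
      ...   | refl = proper z~v same
      two-undominated y₁ z₂ same threes | 2 , v , v₂ , _ , z≢v = z≢v (carrier-unique z₂ v₂)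
      two-undominated y₁ z₂ same threes | 3 , w , w₃ , opposite , _ = opposite (trans same (sym (threes w w₃)))
      two-undominated y₁ z₂ same threes | suc (suc (suc (suc _))) , _ , _ , ()

      one-undominated : ∀ {y} → Carries 1 y → Coloured 3 (c y) → ⊥
      one-undominated {y} y₁ threes with dominator y
      ... | 0 , v , v₀ , refl = 0≢1+n (carried-label-unique v₀ y₁)
      ... | 1 , v , v₁ , y~v with carrier-unique v₁ y₁
      ...   | refl = irrefl Γ y~v
      one-undominated y₁ threes | 2 , z , z₂ , same , _ = two-undominated y₁ z₂ (sym same) threes
      one-undominated y₁ threes | 3 , w , w₃ , opposite , _ = opposite (sym (threes w w₃))
      one-undominated y₁ threes | suc (suc (suc (suc _))) , _ , _ , ()

      -- A neighbour r ≠ x of w can only be dominated by a label-1 vertex, which has the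
      -- colour of w and is then itself undominated.
      three-needs-opposite-two : ∀ {w} → Carries 3 w → Coloured 2 (c w) → ⊥
      three-needs-opposite-two {w} w₃ twos with neighbour-avoiding Γ (two-neighbours w) x
      ... | r , w~r , r≢x with dominator r
      ...   | 0 , v , v₀ , refl = r≢x (carrier-unique v₀ x-carries-0)
      ...   | 1 , y , y₁ , r~y = one-undominated y₁ λ w′ w′₃ →
                trans (cong c (carrier-unique w′₃ w₃)) (both-≢⇒≡ (proper w~r) (proper r~y ∘ sym))
      ...   | 2 , z , z₂ , same , _ = proper w~r (trans (sym (twos z z₂)) (sym same))
      ...   | 3 , v , v₃ , _ , r≁v = r≁v (subst (Adj Γ r) (carrier-unique w₃ v₃) (adj-sym Γ w~r))
      ...   | suc (suc (suc (suc _))) , _ , _ , ()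

      -- A vertex q ≠ x of colour b can only be dominated by a label-1 neighbour y; a vertex
      -- far from y again has colour b, so only x can dominate it.
      one-with-far-zero : ∀ {b} → Coloured 3 b → (∀ z → Carries 2 z → c z ≢ b) →
                          ∃[ y ] (Carries 1 y × ∀ a → Far y a → a ≡ x)
      one-with-far-zero {b} threes avoid with vertex-of-colour≢x b
      ... | q , cq≡b , q≢x with dominator q
      ...   | 0 , v , v₀ , refl = ⊥-elim (q≢x (carrier-unique v₀ x-carries-0))
      ...   | 2 , z , z₂ , same , _ = ⊥-elim (avoid z z₂ (trans (sym same) cq≡b))
      ...   | 3 , w , w₃ , opposite , _ = ⊥-elim (opposite (trans cq≡b (sym (threes w w₃))))
      ...   | suc (suc (suc (suc _))) , _ , _ , ()
      ...   | 1 , y , y₁ , q~y = y , y₁ , λ a (opposite , y≁a) →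
                non-neighbour-of-colour⇒x a y≁a (trans (both-≢⇒≡ (opposite ∘ sym) (proper q~y)) cq≡b)
        where
        non-neighbour-of-colour⇒x : ∀ a → ¬ Adj Γ y a → c a ≡ b → a ≡ x
        non-neighbour-of-colour⇒x a y≁a ca≡b with dominator a
        ... | 0 , v , v₀ , refl = carrier-unique v₀ x-carries-0
        ... | 1 , v , v₁ , a~v = ⊥-elim (y≁a (adj-sym Γ (subst (Adj Γ a) (carrier-unique v₁ y₁) a~v)))
        ... | 2 , z , z₂ , same , _ = ⊥-elim (avoid z z₂ (trans (sym same) ca≡b))
        ... | 3 , w , w₃ , opposite , _ = ⊥-elim (opposite (trans ca≡b (sym (threes w w₃))))
        ... | suc (suc (suc (suc _))) , _ , _ , ()

      colour-avoided-by-two : ∃[ b ] (∀ z → Carries 2 z → c z ≢ b)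
      colour-avoided-by-two with carrier? 2
      ... | yes (z , z₂) = not (c z) , λ z′ z′₂ → not-¬ (cong c (carrier-unique z′₂ z₂))
      ... | no ∄z        = true , λ z z₂ _ → ∄z (z , z₂)

      carrier-3 : ∃[ w ] Carries 3 w
      carrier-3 with carrier? 3
      ... | yes w₃ = w₃
      ... | no ∄w  =
        let (b , avoid) = colour-avoided-by-two
            (y , y₁ , _) = one-with-far-zero (no-three b) avoid
        in ⊥-elim (one-undominated y₁ (no-three (c y)))
        where
        no-three : ∀ b → Coloured 3 b
        no-three _ w w₃ = ⊥-elim (∄w (w , w₃))

      carrier-2 : ∀ {w} → Carries 3 w → ∃[ z ] Carries 2 z
      carrier-2 w₃ with carrier? 2
      ... | yes z₂ = z₂
      ... | no ∄z  = ⊥-elim (three-needs-opposite-two w₃ λ z z₂ → ⊥-elim (∄z (z , z₂)))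

      two-avoids-colour-of-three : ∀ {w} → Carries 3 w → ∀ z → Carries 2 z → c z ≢ c w
      two-avoids-colour-of-three w₃ z z₂ same =
        three-needs-opposite-two w₃ λ z′ z′₂ → trans (cong c (carrier-unique z′₂ z₂)) same

      far-from-one-is-zero : ∃[ y ] (Carries 1 y × ∀ a → Far y a → a ≡ x)
      far-from-one-is-zero =
        let (w , w₃) = carrier-3 in
        one-with-far-zero (λ w′ w′₃ → cong c (carrier-unique w′₃ w₃)) (two-avoids-colour-of-three w₃)

      4≤k : 4 ≤ k
      4≤k = carriers⇒≤ λ where
        0F → x , x-carries-0
        1F → proj₁ far-from-one-is-zero , proj₁ (proj₂ far-from-one-is-zero)
        2F → carrier-2 (proj₂ carrier-3)
        3F → carrier-3

    module CrownEIDS {N : ℕ} (φ : V ↔ (Fin (3 + N) ⊎ Fin (3 + N)))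
                     (φ-iso : IsIsomorphism Γ φ (CrownAdj (3 + N))) where
      open Inverse φ using (to; from; strictlyInverseʳ)

      a b : Fin (3 + N) → V
      a i = from (inj₁ i)
      b j = from (inj₂ j)

      a~b : ∀ {i j} → i ≢ j → Adj Γ (a i) (b j)
      a~b {i} {j} = proj₂ (isomorphism-from Γ φ {CrownAdj (3 + N)} φ-iso (inj₁ i) (inj₂ j))

      a≁b : ∀ i → ¬ Adj Γ (a i) (b i)
      a≁b i a~b = proj₁ (isomorphism-from Γ φ {CrownAdj (3 + N)} φ-iso (inj₁ i) (inj₂ i)) a~b refl

      a-colour : ∀ i → c (a i) ≡ c (a 0F)
      a-colour i =
        let (k , k≢0 , k≢i) = other i in both-≢⇒≡ (proper (a~b (k≢i ∘ sym))) (proper (a~b (k≢0 ∘ sym)))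
        where
        other : ∀ i → ∃[ k ] (k ≢ 0F × k ≢ i)
        other 0F            = 1F , (λ ()) , (λ ())
        other 1F            = 2F , (λ ()) , (λ ())
        other (suc (suc _)) = 1F , (λ ()) , (λ ())

      a₀-b₀-far : Far (a 0F) (b 0F)
      a₀-b₀-far = (λ e → proper (a~b {1F} {0F} (λ ())) (trans (a-colour 1F) e)) , a≁b 0F

      pick : Fin 4 → Fin (3 + N) ⊎ Fin (3 + N)
      pick 0F = inj₂ 1F
      pick 1F = inj₁ 1F
      pick 2F = inj₁ 0F
      pick 3F = inj₂ 0F

      unpick : Fin (3 + N) ⊎ Fin (3 + N) → Fin 4
      unpick (inj₂ (suc _)) = 0F
      unpick (inj₁ (suc _)) = 1F
      unpick (inj₁ zero)    = 2F
      unpick (inj₂ zero)    = 3F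

      pick-injective : Injective _≡_ _≡_ pick
      pick-injective {i} {j} e = trans (sym (unpick-pick i)) (trans (cong unpick e) (unpick-pick j))
        where
        unpick-pick : ∀ i → unpick (pick i) ≡ i
        unpick-pick 0F = refl
        unpick-pick 1F = refl
        unpick-pick 2F = refl
        unpick-pick 3F = refl

      dominator : ∀ t → ∃[ i ] Reach (from (pick i)) (toℕ i) (from t)
      dominator (inj₁ zero)          = 3F , a₀-b₀-far
      dominator (inj₁ (suc j))       =
        2F , a-colour (suc j) , λ e → 0F≢suc (sym (inj₁-injective (↔-to-injective (↔-sym φ) e)))
      dominator (inj₂ 0F)            = 1F , adj-sym Γ (a~b (λ ()))
      dominator (inj₂ 1F)            = 0F , refl
      dominator (inj₂ (suc (suc j))) = 1F , adj-sym Γ (a~b (λ ()))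

      crown-eids : EIDS Γ 4
      crown-eids = record
        { vertex           = from ∘ pick
        ; label            = toℕ
        ; vertex-injective = pick-injective ∘ ↔-to-injective (↔-sym φ)
        ; label-injective  = toℕ-injective
        ; has-zero         = 0F , refl
        ; dominating       = λ u →
            let (i , reach) = dominator (to u)
            in i , subst (Dominates Γ (from (pick i)) (toℕ i)) (strictlyInverseʳ u) (reach⇒dominates (toℕ i) reach)
        }

theorem3p3 : (Γ : Graph) → VertexTransitive Γ → Bipartite Γ → Diameter Γ 3 →
    AdmitsOptimalEIDS Γ ⇔ IsCrownGraph Γ
theorem3p3 Γ vt (c , proper) (close , u₀ , _ , diametral) = mk⇔ crown-of-eids eids-of-crown
  where
  open Bipartite Γ c proper
  open DiameterAtMost3 close
  open Transitive vt diametral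

  crown-of-eids : AdmitsOptimalEIDS Γ → IsCrownGraph Γ
  crown-of-eids (_ , E , _) =
    let (_ , _ , far-from-one) = EIDSAnalysis.far-from-one-is-zero two-neighbours E
    in UniqueAntipodes.crown adj? far-exists (far-unique far-from-one) u₀ two-neighbours

  eids-of-crown : IsCrownGraph Γ → AdmitsOptimalEIDS Γ
  eids-of-crown (_ , s≤s (s≤s (s≤s _)) , φ , φ-iso) =
    4 , crown-eids , crown-eids , λ _ E → EIDSAnalysis.4≤k two-neighbours E
    where open CrownEIDS φ φ-iso
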